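{- For the complete graph $K_n$ with $n\ge 4$, $$b_t^2(K_n)=2n-4.$$
   Context: $K_n$ is the complete graph on $n$ vertices; $\gamma_t(K_n)=2$. A total dominating set of a graph without isolated vertices is a vertex set $S$ such that every vertex is adjacent to some vertex of $S$; $\gamma_t(G)$ is the minimum size of such a set. The $k$-total bondage number $b_t^k(G)$ is the minimum number of edges that must be deleted from $G$ so that the resulting graph (required to have no isolated vertices) has total domination number at least $\gamma_t(G)+k$. -}

module Defs where

open import Data.Nat using (ℕ; _+_; _≤_; _<ᵇ_)
open import Data.Bool using (Bool; true; false; not; _∧_; if_then_else_)
open import Data.Fin using (Fin; toℕ; _≟_)
open import Data.Fin.Subset using (Subset; _∈_; ∣_∣)
open import Data.List using (map; allFin)
open import Data.Nat.ListAction using (sum)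
open import Data.Product using (Σ; ∃; _×_)
open import Relation.Binary.PropositionalEquality using (_≡_)
open import Relation.Nullary using (does)

Adj : ℕ → Set
Adj n = Fin n → Fin n → Bool

IsSimple : ∀ {n} → Adj n → Set
IsSimple {n} A = (∀ (i j : Fin n) → A i j ≡ A j i) × (∀ (i : Fin n) → A i i ≡ false)

complete : (n : ℕ) → Adj n
complete n i j = not (does (i ≟ j))

SpanningSubgraph : ∀ {n} → Adj n → Adj n → Set
SpanningSubgraph {n} H G = ∀ (i j : Fin n) → H i j ≡ true → G i j ≡ true

edgeCount : ∀ {n} → Adj n → ℕ
edgeCount {n} A =
  sum (map (λ i → sum (map (λ j → if (toℕ i <ᵇ toℕ j) ∧ A i j then 1 else 0) (allFin n))) (allFin n))

NoIsolated : ∀ {n} → Adj n → Set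
NoIsolated {n} A = ∀ (v : Fin n) → ∃ λ (u : Fin n) → A v u ≡ true

TotalDominating : ∀ {n} → Adj n → Subset n → Set
TotalDominating {n} A S = ∀ (v : Fin n) → ∃ λ (u : Fin n) → u ∈ S × A v u ≡ true

IsTotalDomNumber : ∀ {n} → Adj n → ℕ → Set
IsTotalDomNumber {n} A g =
  (∃ λ (S : Subset n) → TotalDominating A S × ∣ S ∣ ≡ g)
  × (∀ (S : Subset n) → TotalDominating A S → g ≤ ∣ S ∣)

KBondageWitness : ∀ {n} → ℕ → Adj n → ℕ → Set
KBondageWitness {n} k G m = ∃ λ (H : Adj n) →
  IsSimple H × SpanningSubgraph H G × NoIsolated H
  × (edgeCount G Data.Nat.∸ edgeCount H ≡ m)
  × (∀ (g h : ℕ) → IsTotalDomNumber G g → IsTotalDomNumber H h → g + k ≤ h)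

IsKTotalBondage : ∀ {n} → ℕ → Adj n → ℕ → Set
IsKTotalBondage k G b = KBondageWitness k G b × (∀ (m : ℕ) → KBondageWitness k G m → b ≤ m)

-- Deleting the 2n − 4 edges between {0, 1} and the other vertices of Kₙ leaves K₂ ∪ Kₙ₋₂, whose
-- total domination number is 4 = γₜ(Kₙ) + 2. Conversely, let H be Kₙ minus some edges with
-- γₜ(H) ≥ 4, so that no three vertices totally dominate H, and let d(i) be the number of deleted
-- edges at i. Every vertex has d ≥ 2. If H has a K₂ component, its two ends have d ≥ n − 2. If it
-- has none, d ≥ 3 everywhere, and when some v has d(v) = 3 its three non-neighbours A either
-- contain a vertex with d ≥ n − 3, or every vertex outside A ∪ {v} misses two vertices of A and A
-- misses an edge, which double counting turns into ∑ d ≥ 5(n − 3) + 3. In all cases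
-- ∑ d ≥ 4n − 8, and ∑ d is twice the number of deleted edges.
module Submission where

open import Defs
open import Data.Nat using (ℕ; zero; suc; _+_; _*_; _∸_; _≤_; _<_; _<ᵇ_; z≤n; s≤s)
open import Data.Nat.Properties
  using (module ≤-Reasoning; +-*-semiring; ≤-refl; ≤-trans; ≤-reflexive; +-mono-≤; +-assoc; m≤m+n; m≤n+m; *-zeroʳ; *-identityʳ; +-identityʳ;
         ≤-antisym; m+n∸m≡n; m+n∸n≡m; ∸-monoˡ-≤; *-cancelˡ-≤; *-cancelˡ-≡; +-monoˡ-≤; *-monoʳ-≤; *-monoˡ-≤; *-identityˡ; <⇒≱; *-comm; +-monoʳ-≤; n≤1+n; +-suc; n≤0⇒n≡0; m≤n⇒m≤1+n; ≰⇒>; _≤?_; <⇒≯; ≮⇒≥; <ᵇ⇒<; <⇒<ᵇ)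
open import Data.Bool using (Bool; true; false; not; _∧_; _∨_; _xor_; if_then_else_; T)
open import Data.Bool.Properties using (xor-comm; ¬-not)
import Data.Bool as Bool
open import Data.Fin using (Fin; zero; suc; _≟_; toℕ)
open import Data.Fin.Properties using (toℕ-injective; all?; any?; ¬∀⟶∃¬)
open import Data.Fin.Subset using (Subset; _∈_; ∣_∣; ⁅_⁆; _∪_; _-_)
open import Data.Fin.Subset.Properties using (x∈⁅x⁆; x∈p∪q⁺; ∣⁅x⁆∣≡1; x∈p∧x≢y⇒x∈p-y; x∈p⇒∣p-x∣<∣p∣; _∈?_; anySubset?)
open import Data.Vec using ([]; _∷_)
open import Data.List using (List; []; _∷_; length; map; tabulate; allFin)
open import Data.List.Properties using (map-tabulate)
import Data.Nat.ListAction as List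
open import Data.List.Relation.Unary.All using (All; []; _∷_)
import Data.List.Relation.Unary.All as All
open import Data.List.Relation.Unary.AllPairs using (AllPairs; []; _∷_)
open import Function using (_∘_; id)
open import Data.Product using (_×_; _,_; ∃; proj₁; proj₂)
open import Data.Sum using (_⊎_; inj₁; inj₂)
open import Relation.Binary.PropositionalEquality
open import Relation.Nullary using (Dec; does; yes; no; ¬_; contradiction)
open import Relation.Nullary.Decidable using (dec-true; dec-false; _×-dec_; _→-dec_; ¬?)
open import Data.Nat.Tactic.RingSolver using (solve-∀)
open import Algebra.Properties.Semiring.Sum +-*-semiring
  using (sum-syntax; sum-cong-≗; ∑-distrib-+; ∑-comm; *-distribˡ-sum)

-- Finite sums over Fin n

𝟙 : Bool → ℕ
𝟙 b = if b then 1 else 0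

infix 4 _≡ᵇ_
_≡ᵇ_ : ∀ {n} → Fin n → Fin n → Bool
i ≡ᵇ j = does (i ≟ j)

≡ᵇ-refl : ∀ {n} (i : Fin n) → (i ≡ᵇ i) ≡ true
≡ᵇ-refl i = dec-true (i ≟ i) refl

≢⇒≡ᵇ-false : ∀ {n} {i j : Fin n} → i ≢ j → (i ≡ᵇ j) ≡ false
≢⇒≡ᵇ-false {i = i} {j} = dec-false (i ≟ j)

≡ᵇ-sym : ∀ {n} (i j : Fin n) → (i ≡ᵇ j) ≡ (j ≡ᵇ i)
≡ᵇ-sym i j with i ≟ j
... | yes refl = sym (≡ᵇ-refl i)
... | no i≢j = sym (≢⇒≡ᵇ-false (i≢j ∘ sym))

∑-const : ∀ n k → ∑[ i < n ] k ≡ n * k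
∑-const zero k = refl
∑-const (suc n) k = cong (k +_) (∑-const n k)

∑-mono-≤ : ∀ {n} {f g : Fin n → ℕ} → (∀ i → f i ≤ g i) → ∑[ i < n ] f i ≤ ∑[ i < n ] g i
∑-mono-≤ {zero} f≤g = z≤n
∑-mono-≤ {suc n} f≤g = +-mono-≤ (f≤g zero) (∑-mono-≤ (f≤g ∘ suc))

∑-indicator : ∀ {n} (a : Fin n) → ∑[ j < n ] 𝟙 (j ≡ᵇ a) ≡ 1
∑-indicator {suc n} zero    = cong suc (trans (∑-const n 0) (*-zeroʳ n))
∑-indicator {suc n} (suc a) = ∑-indicator a

erase : ∀ {n} → Fin n → (Fin n → ℕ) → Fin n → ℕ
erase a f j = if j ≡ᵇ a then 0 else f j

erase-≢ : ∀ {n} {a j : Fin n} (f : Fin n → ℕ) → a ≢ j → erase a f j ≡ f j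
erase-≢ f a≢j rewrite ≢⇒≡ᵇ-false (a≢j ∘ sym) = refl

∑-erase : ∀ {n} (a : Fin n) (f : Fin n → ℕ) → ∑[ j < n ] f j ≡ f a + ∑[ j < n ] erase a f j
∑-erase zero f = refl
∑-erase (suc a) f = begin
  f zero + ∑[ j < _ ] f (suc j)                        ≡⟨ cong (f zero +_) (∑-erase a (f ∘ suc)) ⟩
  f zero + (f (suc a) + ∑[ j < _ ] erase a (f ∘ suc) j) ≡⟨ swap (f zero) (f (suc a)) _ ⟩
  f (suc a) + (f zero + ∑[ j < _ ] erase a (f ∘ suc) j) ∎
  where
  open ≡-Reasoning
  swap : ∀ x y z → x + (y + z) ≡ y + (x + z)
  swap = solve-∀

length≤∑ : ∀ {n} {f : Fin n → ℕ} (as : List (Fin n)) →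
  AllPairs _≢_ as → All (λ a → 1 ≤ f a) as → length as ≤ ∑[ j < n ] f j
length≤∑ [] [] [] = z≤n
length≤∑ {f = f} (a ∷ as) (a≢as ∷ distinct) (fa≥1 ∷ fas≥1) =
  subst (suc (length as) ≤_) (sym (∑-erase a f))
    (+-mono-≤ fa≥1 (length≤∑ as distinct (All.zipWith erase≥1 (a≢as , fas≥1))))
  where
  erase≥1 : ∀ {b} → a ≢ b × 1 ≤ f b → 1 ≤ erase a f b
  erase≥1 (a≢b , fb≥1) = subst (1 ≤_) (sym (erase-≢ f a≢b)) fb≥1

n*k≤∑-except : ∀ {n} {f : Fin n → ℕ} {k} (es : List (Fin n)) →
  (∀ j → All (_≢ j) es → k ≤ f j) → n * k ≤ ∑[ j < n ] f j + length es * k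
n*k≤∑-except {n} {f} {k} [] f≥k = begin
  n * k               ≡⟨ ∑-const n k ⟨
  ∑[ j < n ] k        ≤⟨ ∑-mono-≤ (λ j → f≥k j []) ⟩
  ∑[ j < n ] f j      ≡⟨ +-identityʳ _ ⟨
  ∑[ j < n ] f j + 0  ∎
  where open ≤-Reasoning
n*k≤∑-except {n} {f} {k} (a ∷ es) f≥k = begin
  n * k                                                     ≤⟨ n*k≤∑-except {f = g} es g≥k ⟩
  ∑[ j < n ] g j + length es * k                            ≡⟨ cong (_+ length es * k) (∑-distrib-+ f _) ⟩
  ∑[ j < n ] f j + ∑[ j < n ] (k * 𝟙 (j ≡ᵇ a)) + length es * k
                                                            ≡⟨ cong (λ t → ∑[ j < n ] f j + t + length es * k) k-at-a ⟩
  ∑[ j < n ] f j + k + length es * k                        ≡⟨ +-assoc (∑[ j < n ] f j) k _ ⟩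
  ∑[ j < n ] f j + length (a ∷ es) * k                      ∎
  where
  open ≤-Reasoning
  g : Fin n → ℕ
  g j = f j + k * 𝟙 (j ≡ᵇ a)
  k-at-a : ∑[ j < n ] (k * 𝟙 (j ≡ᵇ a)) ≡ k
  k-at-a = trans (sym (*-distribˡ-sum k (λ j → 𝟙 (j ≡ᵇ a)))) (trans (cong (k *_) (∑-indicator a)) (*-identityʳ k))
  g≥k : ∀ j → All (_≢ j) es → k ≤ g j
  g≥k j j∉es with j ≟ a
  ... | yes _ = ≤-trans (≤-reflexive (sym (*-identityʳ k))) (m≤n+m _ (f j))
  ... | no j≢a = ≤-trans (f≥k j ((j≢a ∘ sym) ∷ j∉es)) (m≤m+n (f j) _)

𝟙-split : ∀ b k → k ≡ 𝟙 (not b) * k + 𝟙 b * k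
𝟙-split true k = sym (+-identityʳ k)
𝟙-split false k = sym (trans (+-identityʳ (k + 0)) (+-identityʳ k))

∑∑-split : ∀ {n} (c : Fin n → Fin n → ℕ) → (∀ i j → c i j ≡ c j i) → (p : Fin n → Bool) →
  ∑[ i < n ] ∑[ j < n ] c i j ≡
  ∑[ i < n ] (𝟙 (not (p i)) * ∑[ j < n ] c i j + ∑[ j < n ] (𝟙 (p j) * c i j))
∑∑-split {n} c c-sym p = begin
  ∑[ i < n ] ∑[ j < n ] c i j
    ≡⟨ sum-cong-≗ (λ i → trans (sum-cong-≗ (λ j → 𝟙-split (p i) (c i j))) (∑-distrib-+ {n} _ _)) ⟩
  ∑[ i < n ] (∑[ j < n ] (𝟙 (not (p i)) * c i j) + ∑[ j < n ] (𝟙 (p i) * c i j))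
    ≡⟨ ∑-distrib-+ {n} _ _ ⟩
  ∑[ i < n ] ∑[ j < n ] (𝟙 (not (p i)) * c i j) + ∑[ i < n ] ∑[ j < n ] (𝟙 (p i) * c i j)
    ≡⟨ cong₂ _+_ (sum-cong-≗ (λ i → *-distribˡ-sum (𝟙 (not (p i))) (c i))) ∑-transpose ⟨
  ∑[ i < n ] (𝟙 (not (p i)) * ∑[ j < n ] c i j) + ∑[ i < n ] ∑[ j < n ] (𝟙 (p j) * c i j)
    ≡⟨ ∑-distrib-+ {n} _ _ ⟨
  ∑[ i < n ] (𝟙 (not (p i)) * ∑[ j < n ] c i j + ∑[ j < n ] (𝟙 (p j) * c i j)) ∎
  where
  open ≡-Reasoning
  ∑-transpose : ∑[ i < n ] ∑[ j < n ] (𝟙 (p j) * c i j) ≡ ∑[ i < n ] ∑[ j < n ] (𝟙 (p i) * c i j)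
  ∑-transpose = trans (∑-comm {n} {n} _) (sum-cong-≗ λ i → sum-cong-≗ λ j → cong (𝟙 (p i) *_) (c-sym j i))

-- Graphs and their edge counts

Symmetric : ∀ {n} → Adj n → Set
Symmetric {n} G = ∀ (i j : Fin n) → G i j ≡ G j i

Irreflexive : ∀ {n} → Adj n → Set
Irreflexive {n} G = ∀ (i : Fin n) → G i i ≡ false

infixl 6 _∖_
_∖_ : ∀ {n} → Adj n → Adj n → Adj n
(G ∖ H) i j = G i j ∧ not (H i j)

∖-symmetric : ∀ {n} {G H : Adj n} → Symmetric G → Symmetric H → Symmetric (G ∖ H)
∖-symmetric G-sym H-sym i j = cong₂ (λ g h → g ∧ not h) (G-sym i j) (H-sym i j)

∖-irreflexive : ∀ {n} {G : Adj n} (H : Adj n) → Irreflexive G → Irreflexive (G ∖ H)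
∖-irreflexive H G-irr i = cong (_∧ not (H i i)) (G-irr i)

complete-symmetric : ∀ n → Symmetric (complete n)
complete-symmetric n i j = cong not (≡ᵇ-sym i j)

complete-irreflexive : ∀ n → Irreflexive (complete n)
complete-irreflexive n i = cong not (≡ᵇ-refl i)

degree : ∀ {n} → Adj n → Fin n → ℕ
degree {n} G i = ∑[ j < n ] 𝟙 (G i j)

_<ᶠ_ : ∀ {n} → Fin n → Fin n → Bool
i <ᶠ j = toℕ i <ᵇ toℕ j

sum-tabulate : ∀ {n} (f : Fin n → ℕ) → List.sum (tabulate f) ≡ ∑[ i < n ] f i
sum-tabulate {zero} f = refl
sum-tabulate {suc n} f = cong (f zero +_) (sum-tabulate (f ∘ suc))

sum-allFin : ∀ {n} (f : Fin n → ℕ) → List.sum (map f (allFin n)) ≡ ∑[ i < n ] f i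
sum-allFin {n} f = trans (cong List.sum (map-tabulate id f)) (sum-tabulate f)

edgeCount-∑ : ∀ {n} (G : Adj n) → edgeCount G ≡ ∑[ i < n ] ∑[ j < n ] 𝟙 (i <ᶠ j ∧ G i j)
edgeCount-∑ {n} G =
  trans (sum-allFin (λ i → List.sum (map (row i) (allFin n)))) (sum-cong-≗ (λ i → sum-allFin (row i)))
  where
  row : Fin n → Fin n → ℕ
  row i j = 𝟙 (i <ᶠ j ∧ G i j)

<ᵇ-true⇒< : ∀ m k → (m <ᵇ k) ≡ true → m < k
<ᵇ-true⇒< m k m<k = <ᵇ⇒< m k (subst T (sym m<k) _)

<ᵇ-false⇒≮ : ∀ m k → (m <ᵇ k) ≡ false → ¬ m < k
<ᵇ-false⇒≮ m k m≮k m<k = subst T m≮k (<⇒<ᵇ m<k)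

𝟙-orient : ∀ {n} (i j : Fin n) {b : Bool} → (i ≡ j → b ≡ false) →
  𝟙 b ≡ 𝟙 (i <ᶠ j ∧ b) + 𝟙 (j <ᶠ i ∧ b)
𝟙-orient i j {b} i≡j⇒¬b with i <ᶠ j in i<j | j <ᶠ i in j<i
... | true  | false = sym (+-identityʳ (𝟙 b))
... | false | true  = refl
... | true  | true  = contradiction (<ᵇ-true⇒< (toℕ i) (toℕ j) i<j) (<⇒≯ (<ᵇ-true⇒< (toℕ j) (toℕ i) j<i))
... | false | false rewrite i≡j⇒¬b (toℕ-injective (≤-antisym (≮⇒≥ (<ᵇ-false⇒≮ (toℕ j) (toℕ i) j<i)) (≮⇒≥ (<ᵇ-false⇒≮ (toℕ i) (toℕ j) i<j)))) = refl

handshake : ∀ {n} (G : Adj n) → Symmetric G → Irreflexive G →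
  ∑[ i < n ] degree G i ≡ 2 * edgeCount G
handshake {n} G G-sym G-irr = begin
  ∑[ i < n ] ∑[ j < n ] 𝟙 (G i j)
    ≡⟨ sum-cong-≗ (λ i → sum-cong-≗ (λ j → 𝟙-orient i j (λ { refl → G-irr i }))) ⟩
  ∑[ i < n ] ∑[ j < n ] (forward i j + backward i j)
    ≡⟨ trans (sum-cong-≗ (λ i → ∑-distrib-+ (forward i) (backward i))) (∑-distrib-+ {n} (λ i → ∑[ j < n ] forward i j) _) ⟩
  E + ∑[ i < n ] ∑[ j < n ] backward i j
    ≡⟨ cong (E +_) (trans (∑-comm {n} {n} _) (sum-cong-≗ λ i → sum-cong-≗ λ j → cong (λ g → 𝟙 (i <ᶠ j ∧ g)) (G-sym j i))) ⟩
  E + E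
    ≡⟨ cong (E +_) (+-identityʳ E) ⟨
  2 * E
    ≡⟨ cong (2 *_) (edgeCount-∑ G) ⟨
  2 * edgeCount G ∎
  where
  open ≡-Reasoning
  forward backward : Fin n → Fin n → ℕ
  forward i j = 𝟙 (i <ᶠ j ∧ G i j)
  backward i j = 𝟙 (j <ᶠ i ∧ G i j)
  E = ∑[ i < n ] ∑[ j < n ] forward i j

𝟙-∧-∖ : ∀ b g h → (h ≡ true → g ≡ true) → 𝟙 (b ∧ g) ≡ 𝟙 (b ∧ h) + 𝟙 (b ∧ (g ∧ not h))
𝟙-∧-∖ false g     h     _   = refl
𝟙-∧-∖ true  true  true  _   = refl
𝟙-∧-∖ true  true  false _   = refl
𝟙-∧-∖ true  false false _   = refl
𝟙-∧-∖ true  false true  h⇒g = contradiction (h⇒g refl) λ ()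

edgeCount-∖ : ∀ {n} {G H : Adj n} → SpanningSubgraph H G → edgeCount G ≡ edgeCount H + edgeCount (G ∖ H)
edgeCount-∖ {n} {G} {H} H⊆G = begin
  edgeCount G
    ≡⟨ edgeCount-∑ G ⟩
  ∑[ i < n ] ∑[ j < n ] 𝟙 (i <ᶠ j ∧ G i j)
    ≡⟨ sum-cong-≗ (λ i → trans (sum-cong-≗ (λ j → 𝟙-∧-∖ (i <ᶠ j) (G i j) (H i j) (H⊆G i j))) (∑-distrib-+ (kept i) (deleted i))) ⟩
  ∑[ i < n ] (∑[ j < n ] kept i j + ∑[ j < n ] deleted i j)
    ≡⟨ ∑-distrib-+ {n} (λ i → ∑[ j < n ] kept i j) _ ⟩
  ∑[ i < n ] ∑[ j < n ] kept i j + ∑[ i < n ] ∑[ j < n ] deleted i j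
    ≡⟨ cong₂ _+_ (edgeCount-∑ H) (edgeCount-∑ (G ∖ H)) ⟨
  edgeCount H + edgeCount (G ∖ H) ∎
  where
  open ≡-Reasoning
  kept deleted : Fin n → Fin n → ℕ
  kept i j = 𝟙 (i <ᶠ j ∧ H i j)
  deleted i j = 𝟙 (i <ᶠ j ∧ (G ∖ H) i j)

deleted-edges : ∀ {n} {G H : Adj n} → SpanningSubgraph H G → edgeCount G ∸ edgeCount H ≡ edgeCount (G ∖ H)
deleted-edges {H = H} H⊆G rewrite edgeCount-∖ H⊆G = m+n∸m≡n (edgeCount H) _

-- Total domination

∣p∪q∣≤∣p∣+∣q∣ : ∀ {n} (p q : Subset n) → ∣ p ∪ q ∣ ≤ ∣ p ∣ + ∣ q ∣
∣p∪q∣≤∣p∣+∣q∣ []          []          = z≤n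
∣p∪q∣≤∣p∣+∣q∣ (true ∷ p)  (s ∷ q)     = s≤s (≤-trans (∣p∪q∣≤∣p∣+∣q∣ p q) (+-monoʳ-≤ ∣ p ∣ (∣q∣≤∣s∷q∣ s)))
  where
  ∣q∣≤∣s∷q∣ : ∀ s → ∣ q ∣ ≤ ∣ s ∷ q ∣
  ∣q∣≤∣s∷q∣ true = n≤1+n ∣ q ∣
  ∣q∣≤∣s∷q∣ false = ≤-refl
∣p∪q∣≤∣p∣+∣q∣ (false ∷ p) (true ∷ q)  = subst (suc ∣ p ∪ q ∣ ≤_) (sym (+-suc ∣ p ∣ ∣ q ∣)) (s≤s (∣p∪q∣≤∣p∣+∣q∣ p q))
∣p∪q∣≤∣p∣+∣q∣ (false ∷ p) (false ∷ q) = ∣p∪q∣≤∣p∣+∣q∣ p q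

distinct-members≤∣_∣ : ∀ {n} (S : Subset n) (as : List (Fin n)) →
  AllPairs _≢_ as → All (_∈ S) as → length as ≤ ∣ S ∣
distinct-members≤∣ S ∣ [] [] [] = z≤n
distinct-members≤∣ S ∣ (a ∷ as) (a≢as ∷ distinct) (a∈S ∷ as∈S) =
  ≤-trans (s≤s (distinct-members≤∣ S - a ∣ as distinct (All.zipWith ∈S-a (a≢as , as∈S)))) (x∈p⇒∣p-x∣<∣p∣ a∈S)
  where
  ∈S-a : ∀ {b} → a ≢ b × b ∈ S → b ∈ S - a
  ∈S-a (a≢b , b∈S) = x∈p∧x≢y⇒x∈p-y b∈S (a≢b ∘ sym)

triple : ∀ {n} → Fin n → Fin n → Fin n → Subset n
triple a b c = ⁅ a ⁆ ∪ (⁅ b ⁆ ∪ ⁅ c ⁆)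

∣triple∣≤3 : ∀ {n} (a b c : Fin n) → ∣ triple a b c ∣ ≤ 3
∣triple∣≤3 a b c = begin
  ∣ triple a b c ∣                   ≤⟨ ∣p∪q∣≤∣p∣+∣q∣ ⁅ a ⁆ _ ⟩
  ∣ ⁅ a ⁆ ∣ + ∣ ⁅ b ⁆ ∪ ⁅ c ⁆ ∣       ≤⟨ +-monoʳ-≤ ∣ ⁅ a ⁆ ∣ (∣p∪q∣≤∣p∣+∣q∣ ⁅ b ⁆ ⁅ c ⁆) ⟩
  ∣ ⁅ a ⁆ ∣ + (∣ ⁅ b ⁆ ∣ + ∣ ⁅ c ⁆ ∣) ≡⟨ cong₂ _+_ (∣⁅x⁆∣≡1 a) (cong₂ _+_ (∣⁅x⁆∣≡1 b) (∣⁅x⁆∣≡1 c)) ⟩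
  3                                  ∎
  where open ≤-Reasoning

DominatedBy₃ : ∀ {n} → Adj n → Fin n → Fin n → Fin n → Set
DominatedBy₃ {n} G a b c = ∀ (w : Fin n) → G w a ≡ true ⊎ G w b ≡ true ⊎ G w c ≡ true

triple-totalDominating : ∀ {n} {G : Adj n} {a b c} → DominatedBy₃ G a b c → TotalDominating G (triple a b c)
triple-totalDominating {a = a} {b} {c} dom w with dom w
... | inj₁ Gwa        = a , x∈p∪q⁺ (inj₁ (x∈⁅x⁆ a)) , Gwa
... | inj₂ (inj₁ Gwb) = b , x∈p∪q⁺ {p = ⁅ a ⁆} (inj₂ (x∈p∪q⁺ (inj₁ (x∈⁅x⁆ b)))) , Gwb
... | inj₂ (inj₂ Gwc) = c , x∈p∪q⁺ {p = ⁅ a ⁆} (inj₂ (x∈p∪q⁺ {p = ⁅ b ⁆} (inj₂ (x∈⁅x⁆ c)))) , Gwc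

totalDominating? : ∀ {n} (G : Adj n) (S : Subset n) → Dec (TotalDominating G S)
totalDominating? G S = all? (λ v → any? (λ u → (u ∈? S) ×-dec (G v u Bool.≟ true)))

totalDomNumber-exists : ∀ {n} (G : Adj n) k (S : Subset n) → TotalDominating G S → ∣ S ∣ ≤ k →
  ∃ λ h → h ≤ k × IsTotalDomNumber G h
totalDomNumber-exists G zero S S-td ∣S∣≤0 = 0 , z≤n , (S , S-td , n≤0⇒n≡0 ∣S∣≤0) , (λ _ _ → z≤n)
totalDomNumber-exists G (suc k) S S-td ∣S∣≤1+k
  with anySubset? (λ S′ → totalDominating? G S′ ×-dec (∣ S′ ∣ ≤? k))
... | yes (S′ , S′-td , ∣S′∣≤k) =
  let h , h≤k , γ = totalDomNumber-exists G k S′ S′-td ∣S′∣≤k in h , m≤n⇒m≤1+n h≤k , γ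
... | no ∄smaller = suc k , ≤-refl , (S , S-td , ≤-antisym ∣S∣≤1+k (minimal S-td)) , λ _ → minimal
  where
  minimal : ∀ {S′} → TotalDominating G S′ → suc k ≤ ∣ S′ ∣
  minimal {S′} S′-td = ≰⇒> (λ ∣S′∣≤k → ∄smaller (S′ , S′-td , ∣S′∣≤k))

totalDomNumber-unique : ∀ {n} {G : Adj n} {g h} → IsTotalDomNumber G g → IsTotalDomNumber G h → g ≡ h
totalDomNumber-unique ((S , S-td , ∣S∣≡g) , g-min) ((T , T-td , ∣T∣≡h) , h-min) =
  ≤-antisym (subst (_ ≤_) ∣T∣≡h (g-min T T-td)) (subst (_ ≤_) ∣S∣≡g (h-min S S-td))

adjacent⇒≢ : ∀ {n} {G : Adj n} → Irreflexive G → ∀ {u w} → G u w ≡ true → u ≢ w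
adjacent⇒≢ G-irr {u} Guw refl = contradiction (trans (sym Guw) (G-irr u)) λ ()

record DominatingEdge {n} (G : Adj n) (S : Subset n) (a : Fin n) : Set where
  field
    u w : Fin n
    u∈S : u ∈ S
    w∈S : w ∈ S
    Gau : G a u ≡ true
    Guw : G u w ≡ true

dominatingEdge : ∀ {n} {G : Adj n} {S} → TotalDominating G S → ∀ a → DominatingEdge G S a
dominatingEdge S-td a =
  let u , u∈S , Gau = S-td a ; w , w∈S , Guw = S-td u
  in record { u = u ; w = w ; u∈S = u∈S ; w∈S = w∈S ; Gau = Gau ; Guw = Guw }

complete-totalDominating⇒2≤∣_∣ : ∀ {n} (S : Subset n) → TotalDominating (complete n) S → Fin n → 2 ≤ ∣ S ∣
complete-totalDominating⇒2≤∣_∣ {n} S S-td a =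
  distinct-members≤∣ S ∣ (u ∷ w ∷ []) ((adjacent⇒≢ {G = complete n} (complete-irreflexive n) Guw ∷ []) ∷ [] ∷ []) (u∈S ∷ w∈S ∷ [])
  where open DominatingEdge (dominatingEdge S-td a)

complete-totalDomNumber : ∀ {n} {a b : Fin n} → a ≢ b → IsTotalDomNumber (complete n) 2
complete-totalDomNumber {n} {a} {b} a≢b =
  (⁅ a ⁆ ∪ ⁅ b ⁆ , pair-td , ≤-antisym ∣pair∣≤2 (complete-totalDominating⇒2≤∣ _ ∣ pair-td a))
  , λ S S-td → complete-totalDominating⇒2≤∣ S ∣ S-td a
  where
  pair-td : TotalDominating (complete n) (⁅ a ⁆ ∪ ⁅ b ⁆)
  pair-td w with w ≟ a
  ... | yes refl = b , x∈p∪q⁺ {p = ⁅ a ⁆} (inj₂ (x∈⁅x⁆ b)) , cong not (≢⇒≡ᵇ-false a≢b)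
  ... | no w≢a   = a , x∈p∪q⁺ (inj₁ (x∈⁅x⁆ a)) , cong not (≢⇒≡ᵇ-false w≢a)
  ∣pair∣≤2 : ∣ ⁅ a ⁆ ∪ ⁅ b ⁆ ∣ ≤ 2
  ∣pair∣≤2 = ≤-trans (∣p∪q∣≤∣p∣+∣q∣ ⁅ a ⁆ ⁅ b ⁆) (≤-reflexive (cong₂ _+_ (∣⁅x⁆∣≡1 a) (∣⁅x⁆∣≡1 b)))

-- The upper bound: K₂ ∪ Kₙ₋₂

low : ∀ {n} → Fin n → Bool
low i = toℕ i <ᵇ 2

twoCliques : ∀ n → Adj n
twoCliques n i j = complete n i j ∧ not (low i xor low j)

twoCliques-simple : ∀ n → IsSimple (twoCliques n)
twoCliques-simple n =
  (λ i j → cong₂ (λ c s → c ∧ not s) (complete-symmetric n i j) (xor-comm (low i) (low j)))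
  , λ i → cong (_∧ not (low i xor low i)) (complete-irreflexive n i)

twoCliques-spanning : ∀ n → SpanningSubgraph (twoCliques n) (complete n)
twoCliques-spanning n i j = proj₁ ∘ ∧-true (complete n i j)
  where
  ∧-true : ∀ a {b} → a ∧ b ≡ true → a ≡ true × b ≡ true
  ∧-true true b≡true = refl , b≡true

twoCliques-noIsolated : ∀ k → NoIsolated (twoCliques (4 + k))
twoCliques-noIsolated k zero                = suc zero , refl
twoCliques-noIsolated k (suc zero)          = zero , refl
twoCliques-noIsolated k (suc (suc zero))    = suc (suc (suc zero)) , refl
twoCliques-noIsolated k (suc (suc (suc _))) = suc (suc zero) , refl

twoCliques⇒low-≡ : ∀ {n} (i j : Fin n) → twoCliques n i j ≡ true → low i ≡ low j
twoCliques⇒low-≡ {n} i j Tij with complete n i j | low i | low j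
... | true | true  | true  = refl
... | true | false | false = refl

twoCliques-totalDominating⇒4≤∣_∣ : ∀ k (S : Subset (4 + k)) → TotalDominating (twoCliques (4 + k)) S → 4 ≤ ∣ S ∣
twoCliques-totalDominating⇒4≤∣_∣ k S S-td =
  distinct-members≤∣ S ∣ (L.u ∷ L.w ∷ R.u ∷ R.w ∷ [])
    ( (adjacent L.Guw ∷ apart Lu Ru ∷ apart Lu Rw ∷ [])
    ∷ (apart Lw Ru ∷ apart Lw Rw ∷ [])
    ∷ (adjacent R.Guw ∷ [])
    ∷ [] ∷ [])
    (L.u∈S ∷ L.w∈S ∷ R.u∈S ∷ R.w∈S ∷ [])
  where
  module L = DominatingEdge (dominatingEdge S-td zero)
  module R = DominatingEdge (dominatingEdge S-td (suc (suc zero)))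
  adjacent : ∀ {u w} → twoCliques (4 + k) u w ≡ true → u ≢ w
  adjacent = adjacent⇒≢ {G = twoCliques (4 + k)} (proj₂ (twoCliques-simple (4 + k)))
  apart : ∀ {u w : Fin (4 + k)} → low u ≡ true → low w ≡ false → u ≢ w
  apart lu lw refl = contradiction (trans (sym lu) lw) λ ()
  Lu : low L.u ≡ true
  Lu = sym (twoCliques⇒low-≡ zero L.u L.Gau)
  Lw : low L.w ≡ true
  Lw = trans (sym (twoCliques⇒low-≡ L.u L.w L.Guw)) Lu
  Ru : low R.u ≡ false
  Ru = sym (twoCliques⇒low-≡ (suc (suc zero)) R.u R.Gau)
  Rw : low R.w ≡ false
  Rw = trans (sym (twoCliques⇒low-≡ R.u R.w R.Guw)) Ru

∧-not-∧-true : ∀ b → b ∧ not (b ∧ true) ≡ false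
∧-not-∧-true true  = refl
∧-not-∧-true false = refl

twoCliques-deleted : ∀ m → edgeCount (complete (2 + m) ∖ twoCliques (2 + m)) ≡ 2 * m
twoCliques-deleted m = *-cancelˡ-≡ _ _ 2 (begin
  2 * edgeCount Deleted               ≡⟨ handshake Deleted Deleted-sym Deleted-irr ⟨
  ∑[ i < 2 + m ] degree Deleted i     ≡⟨ cong₂ (λ d₀ d₁ → d₀ + (d₁ + ∑[ i < m ] degree Deleted (suc (suc i)))) low-degree low-degree ⟩
  m + (m + ∑[ i < m ] degree Deleted (suc (suc i)))
                                      ≡⟨ cong (λ d → m + (m + d)) (trans (sum-cong-≗ high-degree) (∑-const m 2)) ⟩
  m + (m + m * 2)                     ≡⟨ arith m ⟩
  2 * (2 * m)                         ∎)
  where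
  open ≡-Reasoning
  -- The two low vertices lose their m edges to the others, each other vertex its 2 edges to them.
  Deleted : Adj (2 + m)
  Deleted = complete (2 + m) ∖ twoCliques (2 + m)
  Deleted-sym : Symmetric Deleted
  Deleted-sym = ∖-symmetric {G = complete (2 + m)} (complete-symmetric (2 + m)) (proj₁ (twoCliques-simple (2 + m)))
  Deleted-irr : Irreflexive Deleted
  Deleted-irr = ∖-irreflexive {G = complete (2 + m)} (twoCliques (2 + m)) (complete-irreflexive (2 + m))
  low-degree : ∑[ j < m ] 1 ≡ m
  low-degree = trans (∑-const m 1) (*-identityʳ m)
  high-degree : ∀ i → degree Deleted (suc (suc i)) ≡ 2
  high-degree i = cong (2 +_) (trans (sum-cong-≗ (λ j → cong 𝟙 (∧-not-∧-true (not (i ≡ᵇ j))))) (trans (∑-const m 0) (*-zeroʳ m)))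
  arith : ∀ m → m + (m + m * 2) ≡ 2 * (2 * m)
  arith = solve-∀

twoCliques-witness : ∀ k → KBondageWitness 2 (complete (4 + k)) (2 * (4 + k) ∸ 4)
twoCliques-witness k =
  twoCliques (4 + k) , twoCliques-simple (4 + k) , twoCliques-spanning (4 + k) , twoCliques-noIsolated k
  , trans (deleted-edges (twoCliques-spanning (4 + k))) (trans (twoCliques-deleted (2 + k)) (sym (arith k)))
  , γₜ-jump
  where
  arith : ∀ k → 2 * (4 + k) ∸ 4 ≡ 2 * (2 + k)
  arith k = unfolded k
    where
    -- the normal form of 2 * (4 + k) ∸ 4
    unfolded : ∀ k → k + (4 + k + 0) ≡ 2 * (2 + k)
    unfolded = solve-∀
  γₜ-jump : ∀ g h → IsTotalDomNumber (complete (4 + k)) g → IsTotalDomNumber (twoCliques (4 + k)) h → g + 2 ≤ h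
  γₜ-jump g h γₜK γₜT rewrite sym (totalDomNumber-unique (complete-totalDomNumber {a = zero} {b = suc zero} (λ ())) γₜK) =
    let S , S-td , ∣S∣≡h = proj₁ γₜT in subst (4 ≤_) ∣S∣≡h (twoCliques-totalDominating⇒4≤∣ k ∣ S S-td)

-- The lower bound

-- Every simple graph H on Fin n is Kₙ minus the edges of Hᶜ; ¬dom₃ expresses γₜ(H) ≥ 4.
module LowerBound {n} (H : Adj n) (H-sym : Symmetric H) (H-irr : Irreflexive H) (H-noIso : NoIsolated H)
  (¬dom₃ : ∀ a b c → ¬ DominatedBy₃ H a b c) where

  Hᶜ : Adj n
  Hᶜ = complete n ∖ H

  codeg : Fin n → ℕ
  codeg = degree Hᶜ

  nonadjacent : ∀ {i j} → i ≢ j → H i j ≡ false → 1 ≤ 𝟙 (Hᶜ i j)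
  nonadjacent i≢j Hij rewrite ≢⇒≡ᵇ-false i≢j | Hij = ≤-refl

  H-adjacent⇒≢ : ∀ {a b} → H a b ≡ true → a ≢ b
  H-adjacent⇒≢ = adjacent⇒≢ {G = H} H-irr

  H-flip : ∀ {a b} → H a b ≡ true → H b a ≡ true
  H-flip {a} {b} = trans (H-sym b a)

  nonadjacent-neighbour : ∀ {v x w} → H v x ≡ false → H x w ≡ true → w ≢ v
  nonadjacent-neighbour {v} {x} Hvx Hxw refl = contradiction (trans (sym Hxw) (trans (H-sym x v) Hvx)) λ ()

  record NonNeighbours₂ (v : Fin n) : Set where
    field
      x y : Fin n
      v≢x : v ≢ x
      v≢y : v ≢ y
      x≢y : x ≢ y
      Hvx : H v x ≡ false
      Hvy : H v y ≡ false

  nonNeighbours₂ : ∀ v → NonNeighbours₂ v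
  nonNeighbours₂ v with any? (λ x → ¬? (v ≟ x) ×-dec (H v x Bool.≟ false))
  ... | no ∄x = contradiction dom (¬dom₃ v u u)
    where
    u : Fin n
    u = proj₁ (H-noIso v)
    dom : DominatedBy₃ H v u u
    dom w with v ≟ w
    ... | yes refl = inj₂ (inj₁ (proj₂ (H-noIso v)))
    ... | no v≢w = inj₁ (H-flip (¬-not λ Hvw → ∄x (w , v≢w , Hvw)))
  ... | yes (x , v≢x , Hvx) with any? (λ y → ¬? (v ≟ y) ×-dec ¬? (x ≟ y) ×-dec (H v y Bool.≟ false))
  ...   | yes (y , v≢y , x≢y , Hvy) = record { v≢x = v≢x ; v≢y = v≢y ; x≢y = x≢y ; Hvx = Hvx ; Hvy = Hvy }
  ...   | no ∄y = contradiction dom (¬dom₃ v w w)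
    where
    w : Fin n
    w = proj₁ (H-noIso x)
    Hxw : H x w ≡ true
    Hxw = proj₂ (H-noIso x)
    Hvw : H v w ≡ true
    Hvw = ¬-not λ Hvw → ∄y (w , nonadjacent-neighbour Hvx Hxw ∘ sym , H-adjacent⇒≢ Hxw , Hvw)
    dom : DominatedBy₃ H v w w
    dom z with v ≟ z | x ≟ z
    ... | yes refl | _        = inj₂ (inj₁ Hvw)
    ... | no _     | yes refl = inj₂ (inj₁ Hxw)
    ... | no v≢z   | no x≢z   = inj₁ (H-flip (¬-not λ Hvz → ∄y (z , v≢z , x≢z , Hvz)))

  codeg≥2 : ∀ i → 2 ≤ codeg i
  codeg≥2 i = length≤∑ (x ∷ y ∷ []) ((x≢y ∷ []) ∷ [] ∷ []) (nonadjacent v≢x Hvx ∷ nonadjacent v≢y Hvy ∷ [])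
    where open NonNeighbours₂ (nonNeighbours₂ i)

  IsolatedEdge : Fin n → Fin n → Set
  IsolatedEdge x y = H x y ≡ true × (∀ j → y ≢ j → H x j ≡ false) × (∀ j → x ≢ j → H y j ≡ false)

  isolatedEdge? : ∀ x y → Dec (IsolatedEdge x y)
  isolatedEdge? x y = (H x y Bool.≟ true)
    ×-dec all? (λ j → ¬? (y ≟ j) →-dec (H x j Bool.≟ false))
    ×-dec all? (λ j → ¬? (x ≟ j) →-dec (H y j Bool.≟ false))

  pendant-neighbour : ∀ {x y} → (∀ w → y ≢ w → H x w ≡ false) → H x y ≡ true
  pendant-neighbour {x} {y} x-pendant with y ≟ proj₁ (H-noIso x) | proj₂ (H-noIso x)
  ... | yes refl | Hxu = Hxu
  ... | no y≢u   | Hxu = contradiction (trans (sym Hxu) (x-pendant _ y≢u)) λ ()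

  pendant-edge-isolated : ∀ {v x y} → H v x ≡ false → H v y ≡ false →
    (∀ w → v ≢ w → x ≢ w → y ≢ w → H v w ≡ true) →
    (∀ w → y ≢ w → H x w ≡ false) → IsolatedEdge x y
  pendant-edge-isolated {v} {x} {y} Hvx Hvy v-adj x-pendant
    with any? (λ w → ¬? (x ≟ w) ×-dec (H y w Bool.≟ true))
  ... | no ∄w = pendant-neighbour x-pendant , x-pendant , λ j x≢j → ¬-not λ Hyj → ∄w (j , x≢j , Hyj)
  ... | yes (w , x≢w , Hyw) = contradiction dom (¬dom₃ v w y)
    where
    Hvw : H v w ≡ true
    Hvw = v-adj w (nonadjacent-neighbour Hvy Hyw ∘ sym) x≢w (H-adjacent⇒≢ Hyw)
    dom : DominatedBy₃ H v w y
    dom z with v ≟ z | x ≟ z | y ≟ z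
    ... | yes refl | _        | _        = inj₂ (inj₁ Hvw)
    ... | no _     | yes refl | _        = inj₂ (inj₂ (pendant-neighbour x-pendant))
    ... | no _     | no _     | yes refl = inj₂ (inj₁ Hyw)
    ... | no v≢z   | no x≢z   | no y≢z   = inj₁ (H-flip (v-adj z v≢z x≢z y≢z))

  record NonNeighbours₃ (v : Fin n) : Set where
    field
      x y z : Fin n
      v≢x : v ≢ x
      v≢y : v ≢ y
      v≢z : v ≢ z
      x≢y : x ≢ y
      x≢z : x ≢ z
      y≢z : y ≢ z
      Hvx : H v x ≡ false
      Hvy : H v y ≡ false
      Hvz : H v z ≡ false

  only-two-nonNeighbours⇒isolatedEdge : ∀ {v x y} → H v x ≡ false → H v y ≡ false →
    (∀ w → v ≢ w → x ≢ w → y ≢ w → H v w ≡ true) → IsolatedEdge x y ⊎ IsolatedEdge y x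
  only-two-nonNeighbours⇒isolatedEdge {v} {x} {y} Hvx Hvy v-adj
    with any? (λ w → ¬? (y ≟ w) ×-dec (H x w Bool.≟ true)) | any? (λ w → ¬? (x ≟ w) ×-dec (H y w Bool.≟ true))
  ... | no ∄w₁ | _ = inj₁ (pendant-edge-isolated Hvx Hvy v-adj (λ w y≢w → ¬-not λ Hxw → ∄w₁ (w , y≢w , Hxw)))
  ... | yes _ | no ∄w₂ = inj₂ (pendant-edge-isolated Hvy Hvx (λ w v≢w y≢w x≢w → v-adj w v≢w x≢w y≢w)
                                (λ w x≢w → ¬-not λ Hyw → ∄w₂ (w , x≢w , Hyw)))
  ... | yes (w₁ , y≢w₁ , Hxw₁) | yes (w₂ , x≢w₂ , Hyw₂) = contradiction dom (¬dom₃ v w₁ w₂)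
    where
    dom : DominatedBy₃ H v w₁ w₂
    dom w with v ≟ w | x ≟ w | y ≟ w
    ... | yes refl | _        | _        = inj₂ (inj₁ (v-adj w₁ (nonadjacent-neighbour Hvx Hxw₁ ∘ sym) (H-adjacent⇒≢ Hxw₁) y≢w₁))
    ... | no _     | yes refl | _        = inj₂ (inj₁ Hxw₁)
    ... | no _     | no _     | yes refl = inj₂ (inj₂ Hyw₂)
    ... | no v≢w   | no x≢w   | no y≢w   = inj₁ (H-flip (v-adj w v≢w x≢w y≢w))

  nonNeighbours₃ : (∀ x y → ¬ IsolatedEdge x y) → ∀ v → NonNeighbours₃ v
  nonNeighbours₃ ¬isolated v
    with nonNeighbours₂ v
  ... | record { x = x ; y = y ; v≢x = v≢x ; v≢y = v≢y ; x≢y = x≢y ; Hvx = Hvx ; Hvy = Hvy }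
    with any? (λ z → ¬? (v ≟ z) ×-dec ¬? (x ≟ z) ×-dec ¬? (y ≟ z) ×-dec (H v z Bool.≟ false))
  ... | yes (z , v≢z , x≢z , y≢z , Hvz) = record
    { v≢x = v≢x ; v≢y = v≢y ; v≢z = v≢z ; x≢y = x≢y ; x≢z = x≢z ; y≢z = y≢z ; Hvx = Hvx ; Hvy = Hvy ; Hvz = Hvz }
  ... | no ∄z with only-two-nonNeighbours⇒isolatedEdge Hvx Hvy (λ w v≢w x≢w y≢w → ¬-not λ Hvw → ∄z (w , v≢w , x≢w , y≢w , Hvw))
  ...   | inj₁ xy-isolated = contradiction xy-isolated (¬isolated x y)
  ...   | inj₂ yx-isolated = contradiction yx-isolated (¬isolated y x)

  codeg≥3 : (∀ x y → ¬ IsolatedEdge x y) → ∀ i → 3 ≤ codeg i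
  codeg≥3 ¬isolated i =
    length≤∑ (x ∷ y ∷ z ∷ []) ((x≢y ∷ x≢z ∷ []) ∷ (y≢z ∷ []) ∷ [] ∷ [])
      (nonadjacent v≢x Hvx ∷ nonadjacent v≢y Hvy ∷ nonadjacent v≢z Hvz ∷ [])
    where open NonNeighbours₃ (nonNeighbours₃ ¬isolated i)

  isolatedEdge-bound : ∀ {x y} → IsolatedEdge x y → 4 * n ≤ ∑[ i < n ] codeg i + 8
  isolatedEdge-bound {x} {y} (Hxy , x-pendant , y-pendant) = begin
    4 * n                                                 ≡⟨ split n ⟩
    n * 1 + (n * 1 + n * 2)                               ≤⟨ +-mono-≤ codeg-x (+-mono-≤ codeg-y rest) ⟩
    (codeg x + 2) + ((codeg y + 2) + (R + 4))             ≡⟨ regroup (codeg x) (codeg y) R ⟩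
    codeg x + (codeg y + R) + 8                           ≡⟨ cong (_+ 8) Σ-split ⟨
    ∑[ i < n ] codeg i + 8                                ∎
    where
    open ≤-Reasoning
    split : ∀ n → 4 * n ≡ n * 1 + (n * 1 + n * 2)
    split = solve-∀
    regroup : ∀ a b r → (a + 2) + ((b + 2) + (r + 4)) ≡ a + (b + r) + 8
    regroup = solve-∀
    x≢y : x ≢ y
    x≢y = H-adjacent⇒≢ Hxy
    R : ℕ
    R = ∑[ j < n ] erase y (erase x codeg) j
    codeg-x : n * 1 ≤ codeg x + 2
    codeg-x = n*k≤∑-except (x ∷ y ∷ []) λ { j (x≢j ∷ y≢j ∷ []) → nonadjacent x≢j (x-pendant j y≢j) }
    codeg-y : n * 1 ≤ codeg y + 2
    codeg-y = n*k≤∑-except (x ∷ y ∷ []) λ { j (x≢j ∷ y≢j ∷ []) → nonadjacent y≢j (y-pendant j x≢j) }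
    rest : n * 2 ≤ R + 4
    rest = n*k≤∑-except (x ∷ y ∷ []) λ { j (x≢j ∷ y≢j ∷ []) →
      subst (2 ≤_) (sym (trans (erase-≢ (erase x codeg) y≢j) (erase-≢ codeg x≢j))) (codeg≥2 j) }
    Σ-split : ∑[ i < n ] codeg i ≡ codeg x + (codeg y + R)
    Σ-split = trans (∑-erase x codeg) (cong (codeg x +_) (trans (∑-erase y (erase x codeg)) (cong (_+ R) (erase-≢ codeg x≢y))))

  codeg≥4-bound : (∀ i → 4 ≤ codeg i) → 4 * n ≤ ∑[ i < n ] codeg i + 8
  codeg≥4-bound codeg≥4 = begin
    4 * n                  ≡⟨ trans (∑-const n 4) (*-comm n 4) ⟨
    ∑[ i < n ] 4           ≤⟨ ∑-mono-≤ codeg≥4 ⟩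
    ∑[ i < n ] codeg i     ≤⟨ m≤m+n _ 8 ⟩
    ∑[ i < n ] codeg i + 8 ∎
    where open ≤-Reasoning

  module LowVertex (¬isolated : ∀ x y → ¬ IsolatedEdge x y) (v : Fin n) (codeg-v<4 : codeg v < 4) where
    open NonNeighbours₃ (nonNeighbours₃ ¬isolated v)

    Outside : Fin n → Set
    Outside b = v ≢ b × x ≢ b × y ≢ b × z ≢ b

    outside? : ∀ b → Dec (Outside b)
    outside? b = ¬? (v ≟ b) ×-dec ¬? (x ≟ b) ×-dec ¬? (y ≟ b) ×-dec ¬? (z ≟ b)

    v-adj : ∀ w → Outside w → H v w ≡ true
    v-adj w (v≢w , x≢w , y≢w , z≢w) = ¬-not λ Hvw → <⇒≱ codeg-v<4
      (length≤∑ (x ∷ y ∷ z ∷ w ∷ []) ((x≢y ∷ x≢z ∷ x≢w ∷ []) ∷ (y≢z ∷ y≢w ∷ []) ∷ (z≢w ∷ []) ∷ [] ∷ [])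
        (nonadjacent v≢x Hvx ∷ nonadjacent v≢y Hvy ∷ nonadjacent v≢z Hvz ∷ nonadjacent v≢w Hvw ∷ []))

    dominated-via : ∀ b b′ → H v b ≡ true →
      (H x b ≡ true ⊎ H x b′ ≡ true) → (H y b ≡ true ⊎ H y b′ ≡ true) → (H z b ≡ true ⊎ H z b′ ≡ true) →
      DominatedBy₃ H v b b′
    dominated-via b b′ Hvb x-dom y-dom z-dom w with v ≟ w | x ≟ w | y ≟ w | z ≟ w
    ... | yes refl | _        | _        | _        = inj₂ (inj₁ Hvb)
    ... | no _     | yes refl | _        | _        = inj₂ x-dom
    ... | no _     | no _     | yes refl | _        = inj₂ y-dom
    ... | no _     | no _     | no _     | yes refl = inj₂ z-dom
    ... | no v≢w   | no x≢w   | no y≢w   | no z≢w   = inj₁ (H-flip (v-adj w (v≢w , x≢w , y≢w , z≢w)))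

    Confined : Fin n → Set
    Confined a = ∀ b → Outside b → H a b ≡ false

    confined? : ∀ a → Dec (Confined a)
    confined? a = all? (λ b → outside? b →-dec (H a b Bool.≟ false))

    record OutsideNeighbour (a : Fin n) : Set where
      field
        b : Fin n
        outside : Outside b
        Hab : H a b ≡ true

    outsideNeighbour : ∀ a → ¬ Confined a → OutsideNeighbour a
    outsideNeighbour a ¬confined with any? (λ b → outside? b ×-dec (H a b Bool.≟ true))
    ... | yes (b , outside , Hab) = record { b = b ; outside = outside ; Hab = Hab }
    ... | no ∄b = contradiction (λ b outside → ¬-not λ Hab → ∄b (b , outside , Hab)) ¬confined

    inA : Fin n → Bool
    inA j = (x ≡ᵇ j) ∨ (y ≡ᵇ j) ∨ (z ≡ᵇ j)

    x∈A : inA x ≡ true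
    x∈A rewrite ≡ᵇ-refl x = refl

    y∈A : inA y ≡ true
    y∈A rewrite ≢⇒≡ᵇ-false x≢y | ≡ᵇ-refl y = refl

    z∈A : inA z ≡ true
    z∈A rewrite ≢⇒≡ᵇ-false x≢z | ≢⇒≡ᵇ-false y≢z | ≡ᵇ-refl z = refl

    ∉A : ∀ {j} → x ≢ j → y ≢ j → z ≢ j → inA j ≡ false
    ∉A x≢j y≢j z≢j rewrite ≢⇒≡ᵇ-false x≢j | ≢⇒≡ᵇ-false y≢j | ≢⇒≡ᵇ-false z≢j = refl

    v∉A : inA v ≡ false
    v∉A = ∉A (v≢x ∘ sym) (v≢y ∘ sym) (v≢z ∘ sym)

    ∈A-∉A-≢ : ∀ {a j} → inA a ≡ true → inA j ≡ false → a ≢ j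
    ∈A-∉A-≢ a∈A j∉A refl = contradiction (trans (sym a∈A) j∉A) λ ()

    ∉A⇒outside : ∀ {j} → v ≢ j → inA j ≡ false → Outside j
    ∉A⇒outside v≢j j∉A = v≢j , ∈A-∉A-≢ x∈A j∉A , ∈A-∉A-≢ y∈A j∉A , ∈A-∉A-≢ z∈A j∉A

    confined-bound : ∀ {a} → inA a ≡ true → H v a ≡ false → Confined a → 4 * n ≤ ∑[ i < n ] codeg i + 8
    confined-bound {a} a∈A Hva confined = begin
      4 * n                                   ≡⟨ split n ⟩
      n * 1 + n * 3                           ≤⟨ +-mono-≤ codeg-a rest ⟩
      (codeg a + 3) + (R + 3)                 ≡⟨ regroup (codeg a) R ⟩
      codeg a + R + 6                         ≤⟨ +-monoʳ-≤ (codeg a + R) (m≤m+n 6 2) ⟩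
      codeg a + R + 8                         ≡⟨ cong (_+ 8) (∑-erase a codeg) ⟨
      ∑[ i < n ] codeg i + 8                  ∎
      where
      open ≤-Reasoning
      split : ∀ n → 4 * n ≡ n * 1 + n * 3
      split = solve-∀
      regroup : ∀ c r → (c + 3) + (r + 3) ≡ c + r + 6
      regroup = solve-∀
      R : ℕ
      R = ∑[ j < n ] erase a codeg j
      codeg-a : n * 1 ≤ codeg a + 3
      codeg-a = n*k≤∑-except (x ∷ y ∷ z ∷ []) λ { j (x≢j ∷ y≢j ∷ z≢j ∷ []) → a-nonadjacent j (∈A-∉A-≢ a∈A (∉A x≢j y≢j z≢j)) x≢j y≢j z≢j }
        where
        a-nonadjacent : ∀ j → a ≢ j → x ≢ j → y ≢ j → z ≢ j → 1 ≤ 𝟙 (Hᶜ a j)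
        a-nonadjacent j a≢j x≢j y≢j z≢j with v ≟ j
        ... | yes refl = nonadjacent a≢j (trans (H-sym a v) Hva)
        ... | no v≢j   = nonadjacent a≢j (confined j (v≢j , x≢j , y≢j , z≢j))
      rest : n * 3 ≤ R + 3
      rest = n*k≤∑-except (a ∷ []) λ { j (a≢j ∷ []) → subst (3 ≤_) (sym (erase-≢ codeg a≢j)) (codeg≥3 ¬isolated j) }

    codegA : Fin n → ℕ
    codegA i = ∑[ j < n ] (𝟙 (inA j) * 𝟙 (Hᶜ i j))

    nonadjacentA : ∀ {i a} → inA a ≡ true → i ≢ a → H i a ≡ false → 1 ≤ 𝟙 (inA a) * 𝟙 (Hᶜ i a)
    nonadjacentA a∈A i≢a Hia rewrite a∈A = ≤-trans (nonadjacent i≢a Hia) (≤-reflexive (sym (+-identityʳ _)))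

    record NonadjacentPair : Set where
      field
        p q : Fin n
        p∈A : inA p ≡ true
        q∈A : inA q ≡ true
        p≢q : p ≢ q
        Hpq : H p q ≡ false

    module _ (ox : OutsideNeighbour x) (oy : OutsideNeighbour y) (oz : OutsideNeighbour z) where
      private
        module X = OutsideNeighbour ox
        module Y = OutsideNeighbour oy
        module Z = OutsideNeighbour oz

      nonadjacentPair : NonadjacentPair
      nonadjacentPair with H x y in Hxy | H x z in Hxz | H y z in Hyz
      ... | false | _     | _     = record { p∈A = x∈A ; q∈A = y∈A ; p≢q = x≢y ; Hpq = Hxy }
      ... | true  | false | _     = record { p∈A = x∈A ; q∈A = z∈A ; p≢q = x≢z ; Hpq = Hxz }
      ... | true  | true  | false = record { p∈A = y∈A ; q∈A = z∈A ; p≢q = y≢z ; Hpq = Hyz }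
      ... | true  | true  | true  = contradiction
        (dominated-via X.b x (v-adj X.b X.outside) (inj₁ X.Hab) (inj₂ (H-flip Hxy)) (inj₂ (H-flip Hxz)))
        (¬dom₃ v X.b x)

      outside-codegA≥2 : ∀ {b} → Outside b → 2 ≤ codegA b
      outside-codegA≥2 {b} outside@(_ , x≢b , y≢b , z≢b) with H b x in Hbx | H b y in Hby | H b z in Hbz
      ... | false | false | _     = length≤∑ (x ∷ y ∷ []) ((x≢y ∷ []) ∷ [] ∷ [])
                                      (nonadjacentA x∈A (x≢b ∘ sym) Hbx ∷ nonadjacentA y∈A (y≢b ∘ sym) Hby ∷ [])
      ... | false | true  | false = length≤∑ (x ∷ z ∷ []) ((x≢z ∷ []) ∷ [] ∷ [])
                                      (nonadjacentA x∈A (x≢b ∘ sym) Hbx ∷ nonadjacentA z∈A (z≢b ∘ sym) Hbz ∷ [])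
      ... | true  | false | false = length≤∑ (y ∷ z ∷ []) ((y≢z ∷ []) ∷ [] ∷ [])
                                      (nonadjacentA y∈A (y≢b ∘ sym) Hby ∷ nonadjacentA z∈A (z≢b ∘ sym) Hbz ∷ [])
      ... | true  | true  | true  = contradiction (dominated-via b b (v-adj b outside) (inj₁ (H-flip Hbx)) (inj₁ (H-flip Hby)) (inj₁ (H-flip Hbz))) (¬dom₃ v b b)
      ... | false | true  | true  = contradiction (dominated-via b X.b (v-adj b outside) (inj₂ X.Hab) (inj₁ (H-flip Hby)) (inj₁ (H-flip Hbz))) (¬dom₃ v b X.b)
      ... | true  | false | true  = contradiction (dominated-via b Y.b (v-adj b outside) (inj₁ (H-flip Hbx)) (inj₂ Y.Hab) (inj₁ (H-flip Hbz))) (¬dom₃ v b Y.b)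
      ... | true  | true  | false = contradiction (dominated-via b Z.b (v-adj b outside) (inj₁ (H-flip Hbx)) (inj₁ (H-flip Hby)) (inj₂ Z.Hab)) (¬dom₃ v b Z.b)

      open NonadjacentPair nonadjacentPair

      -- Counting each deleted edge at both ends, except that an edge at a vertex of A is counted
      -- only at its other end (∑∑-split), vertices outside A weigh at least 5 and v, p, q one more.
      bonus : Fin n → ℕ
      bonus i = 𝟙 (i ≡ᵇ v) + 𝟙 (i ≡ᵇ p) + 𝟙 (i ≡ᵇ q)

      weight : Fin n → ℕ
      weight i = 𝟙 (not (inA i)) * codeg i + codegA i

      bonus≤codegA : ∀ {i} → inA i ≡ true → bonus i ≤ codegA i
      bonus≤codegA {i} i∈A rewrite ≢⇒≡ᵇ-false (∈A-∉A-≢ i∈A v∉A) with p ≟ i | q ≟ i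
      ... | yes refl | _ rewrite ≡ᵇ-refl p | ≢⇒≡ᵇ-false p≢q =
        length≤∑ (q ∷ []) ([] ∷ []) (nonadjacentA q∈A p≢q Hpq ∷ [])
      ... | no _ | yes refl rewrite ≢⇒≡ᵇ-false (p≢q ∘ sym) | ≡ᵇ-refl q =
        length≤∑ (p ∷ []) ([] ∷ []) (nonadjacentA p∈A (p≢q ∘ sym) (trans (H-sym q p) Hpq) ∷ [])
      ... | no p≢i | no q≢i rewrite ≢⇒≡ᵇ-false (p≢i ∘ sym) | ≢⇒≡ᵇ-false (q≢i ∘ sym) = z≤n

      5+bonus≤weight : ∀ {i} → inA i ≡ false → 5 + bonus i ≤ codeg i + codegA i
      5+bonus≤weight {i} i∉A rewrite ≢⇒≡ᵇ-false (∈A-∉A-≢ p∈A i∉A ∘ sym) | ≢⇒≡ᵇ-false (∈A-∉A-≢ q∈A i∉A ∘ sym) with v ≟ i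
      ... | yes refl rewrite ≡ᵇ-refl v = +-mono-≤ (codeg≥3 ¬isolated v)
        (length≤∑ (x ∷ y ∷ z ∷ []) ((x≢y ∷ x≢z ∷ []) ∷ (y≢z ∷ []) ∷ [] ∷ [])
          (nonadjacentA x∈A v≢x Hvx ∷ nonadjacentA y∈A v≢y Hvy ∷ nonadjacentA z∈A v≢z Hvz ∷ []))
      ... | no v≢i rewrite ≢⇒≡ᵇ-false (v≢i ∘ sym) =
        +-mono-≤ (codeg≥3 ¬isolated i) (outside-codegA≥2 (∉A⇒outside v≢i i∉A))

      weight≥ : ∀ i → 5 * 𝟙 (not (inA i)) + bonus i ≤ weight i
      weight≥ i with inA i in membership
      ... | true  = bonus≤codegA membership
      ... | false = subst (5 + bonus i ≤_) (cong (_+ codegA i) (sym (*-identityˡ (codeg i)))) (5+bonus≤weight membership)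

      K : ℕ
      K = ∑[ i < n ] 𝟙 (not (inA i))

      ∑-lower : ∑[ i < n ] (5 * 𝟙 (not (inA i)) + bonus i) ≡ 5 * K + 3
      ∑-lower = trans (∑-distrib-+ {n} (λ i → 5 * 𝟙 (not (inA i))) bonus)
        (cong₂ _+_ (sym (*-distribˡ-sum 5 (λ i → 𝟙 (not (inA i))))) ∑-bonus)
        where
        ∑-bonus : ∑[ i < n ] bonus i ≡ 3
        ∑-bonus = trans (∑-distrib-+ {n} (λ i → 𝟙 (i ≡ᵇ v) + 𝟙 (i ≡ᵇ p)) _)
          (cong₂ _+_ (trans (∑-distrib-+ {n} (λ i → 𝟙 (i ≡ᵇ v)) _) (cong₂ _+_ (∑-indicator v) (∑-indicator p))) (∑-indicator q))

      n≤K+3 : n * 1 ≤ K + 3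
      n≤K+3 = n*k≤∑-except (x ∷ y ∷ z ∷ []) λ { j (x≢j ∷ y≢j ∷ z≢j ∷ []) → ≤-reflexive (sym (cong (𝟙 ∘ not) (∉A x≢j y≢j z≢j))) }

      1≤K : 1 ≤ K
      1≤K = length≤∑ (v ∷ []) ([] ∷ []) (≤-reflexive (sym (cong (𝟙 ∘ not) v∉A)) ∷ [])

      unconfined-bound : 4 * n ≤ ∑[ i < n ] codeg i + 8
      unconfined-bound = begin
        4 * n                                                  ≤⟨ arith n K n≤K+3 1≤K ⟩
        5 * K + 3 + 8                                          ≡⟨ cong (_+ 8) ∑-lower ⟨
        ∑[ i < n ] (5 * 𝟙 (not (inA i)) + bonus i) + 8         ≤⟨ +-monoˡ-≤ 8 (∑-mono-≤ weight≥) ⟩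
        ∑[ i < n ] weight i + 8                                ≡⟨ cong (_+ 8) (∑∑-split (λ i j → 𝟙 (Hᶜ i j)) Hᶜ-sym inA) ⟨
        ∑[ i < n ] codeg i + 8                                 ∎
        where
        open ≤-Reasoning
        Hᶜ-sym : ∀ i j → 𝟙 (Hᶜ i j) ≡ 𝟙 (Hᶜ j i)
        Hᶜ-sym i j = cong 𝟙 (∖-symmetric {G = complete n} (complete-symmetric n) H-sym i j)
        arith : ∀ n K → n * 1 ≤ K + 3 → 1 ≤ K → 4 * n ≤ 5 * K + 3 + 8
        arith n (suc K) n≤K+3 _ = begin
          4 * n                 ≡⟨ cong (4 *_) (*-identityʳ n) ⟨
          4 * (n * 1)           ≤⟨ *-monoʳ-≤ 4 n≤K+3 ⟩
          4 * (suc K + 3)       ≡⟨ e₁ K ⟩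
          4 * K + 16            ≤⟨ +-monoˡ-≤ 16 (*-monoˡ-≤ K (n≤1+n 4)) ⟩
          5 * K + 16            ≡⟨ e₂ K ⟩
          5 * suc K + 3 + 8     ∎
          where
          e₁ : ∀ K → 4 * (suc K + 3) ≡ 4 * K + 16
          e₁ = solve-∀
          e₂ : ∀ K → 5 * K + 16 ≡ 5 * suc K + 3 + 8
          e₂ = solve-∀

    low-vertex-bound : 4 * n ≤ ∑[ i < n ] codeg i + 8
    low-vertex-bound with confined? x | confined? y | confined? z
    ... | yes x-confined | _              | _              = confined-bound x∈A Hvx x-confined
    ... | no _           | yes y-confined | _              = confined-bound y∈A Hvy y-confined
    ... | no _           | no _           | yes z-confined = confined-bound z∈A Hvz z-confined
    ... | no x-free      | no y-free      | no z-free      =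
      unconfined-bound (outsideNeighbour x x-free) (outsideNeighbour y y-free) (outsideNeighbour z z-free)

  codeg-sum-bound : 4 * n ≤ ∑[ i < n ] codeg i + 8
  codeg-sum-bound with any? (λ x → any? (λ y → isolatedEdge? x y))
  ... | yes (_ , _ , isolated) = isolatedEdge-bound isolated
  ... | no ∄isolated with all? (λ i → 4 ≤? codeg i)
  ...   | yes codeg≥4 = codeg≥4-bound codeg≥4
  ...   | no ¬codeg≥4 with ¬∀⟶∃¬ n _ (λ i → 4 ≤? codeg i) ¬codeg≥4
  ...     | v , codeg-v≱4 = LowVertex.low-vertex-bound (λ x y isolated → ∄isolated (x , y , isolated)) v (≰⇒> codeg-v≱4)

4n≤2e+8⇒2n∸4≤e : ∀ n e → 4 * n ≤ 2 * e + 8 → 2 * n ∸ 4 ≤ e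
4n≤2e+8⇒2n∸4≤e n e 4n≤2e+8 = begin
  2 * n ∸ 4        ≤⟨ ∸-monoˡ-≤ 4 (*-cancelˡ-≤ {2 * n} {e + 4} 2 (subst₂ _≤_ (e₁ n) (e₂ e) 4n≤2e+8)) ⟩
  e + 4 ∸ 4        ≡⟨ m+n∸n≡m e 4 ⟩
  e                ∎
  where
  open ≤-Reasoning
  e₁ : ∀ n → 4 * n ≡ 2 * (2 * n)
  e₁ = solve-∀
  e₂ : ∀ e → 2 * e + 8 ≡ 2 * (e + 4)
  e₂ = solve-∀

bondage-lower-bound : ∀ {n} {a b : Fin n} → a ≢ b → ∀ m → KBondageWitness 2 (complete n) m → 2 * n ∸ 4 ≤ m
bondage-lower-bound {n} a≢b m (H , (H-sym , H-irr) , H⊆K , H-noIso , deleted≡m , γₜ-jump) =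
  subst (2 * n ∸ 4 ≤_) (trans (sym (deleted-edges H⊆K)) deleted≡m)
    (4n≤2e+8⇒2n∸4≤e n _ (subst (λ s → 4 * n ≤ s + 8) (handshake Hᶜ Hᶜ-sym Hᶜ-irr) codeg-sum-bound))
  where
  ¬dom₃ : ∀ a b c → ¬ DominatedBy₃ H a b c
  ¬dom₃ a b c dom with totalDomNumber-exists H 3 (triple a b c) (triple-totalDominating dom) (∣triple∣≤3 a b c)
  ... | h , h≤3 , γₜH = <⇒≱ (s≤s h≤3) (γₜ-jump 2 h (complete-totalDomNumber a≢b) γₜH)
  open LowerBound H H-sym H-irr H-noIso ¬dom₃ using (Hᶜ; codeg-sum-bound)
  Hᶜ-sym : Symmetric Hᶜ
  Hᶜ-sym = ∖-symmetric {G = complete n} (complete-symmetric n) H-sym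
  Hᶜ-irr : Irreflexive Hᶜ
  Hᶜ-irr = ∖-irreflexive {G = complete n} H (complete-irreflexive n)

theorem3p12 : (n : ℕ) → 4 ≤ n → IsKTotalBondage 2 (complete n) (2 * n ∸ 4)
theorem3p12 (suc (suc (suc (suc k)))) (s≤s (s≤s (s≤s (s≤s _)))) =
  twoCliques-witness k , bondage-lower-bound {a = zero} {b = suc zero} (λ ())
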